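{- Let $D$ be a digraph in the class $\mathcal{F}=(K_1,\oplus,\overrightarrow{\triangleleft})$. Then $\overrightarrow{\gamma^{\mathrm{ID}}}(D)=|V(D)|$. Furthermore, if a vertex $x$ is a source in $D$, then $V(D)-x$ is a separating code of $D$; otherwise, the vertex $x$ and its father in $\overrightarrow{F}(D)$ form the only pair of distinct vertices of $D$ that is not separated by the set $V(D)-x$.
   Context: Digraphs are finite, without loops or multiple arcs; an arc from $u$ to $v$ is written $\overrightarrow{uv}$. For a vertex $u$, $B_1^+(u)$ denotes the set consisting of $u$ together with all vertices $w$ such that $\overrightarrow{wu}$ is an arc. A source is a vertex with no incoming arc. A set $C\subseteq V(D)$ separates two vertices $u,v$ if $B_1^+(u)\cap C\neq B_1^+(v)\cap C$; $C$ is a separating code if it separates every pair of distinct vertices; $C$ is dominating if $B_1^+(u)\cap C\neq\emptyset$ for all $u$; an identifying code is a dominating separating code. $\overrightarrow{\gamma^{\mathrm{ID}}}(D)$ is the minimum size of an identifying code of $D$. For digraphs $D_1,D_2$ on disjoint vertex sets, $D_1\oplus D_2$ is their disjoint union. For a digraph $D$ and a new vertex $x\notin V(D)$, $x\overrightarrow{\triangleleft}(D)$ is the digraph obtained from $D$ by adding $x$ and all arcs $\overrightarrow{xv}$, $v\in V(D)$. The class $\mathcal{F}=(K_1,\oplus,\overrightarrow{\triangleleft})$ is the closure of the one-vertex digraph $K_1$ under $\oplus$ and $\overrightarrow{\triangleleft}$. A rooted oriented tree is an oriented tree with a root $r$ such that for every vertex $u$ the path between $r$ and $u$ is directed from $r$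 to $u$; for an arc $\overrightarrow{xy}$ in it, $x$ is the father of $y$. A rooted oriented forest is a disjoint union of rooted oriented trees. The transitive closure of a digraph adds the arc $\overrightarrow{xy}$ whenever there is a directed path from $x$ to $y$. Every $D\in\mathcal{F}$ is the transitive closure of a unique rooted oriented forest, denoted $\overrightarrow{F}(D)$. -}

module Defs where

open import Data.Nat using (ℕ; zero; suc; _+_; _≤_)
open import Data.Fin using (Fin; zero; suc; splitAt)
open import Data.Fin.Subset using (Subset; _∈_; _∉_; ∣_∣; ⊤; ⁅_⁆; _─_)
open import Data.Sum using (_⊎_; inj₁; inj₂)
open import Data.Product using (Σ; _×_; _,_; ∃; ∃-syntax)
open import Data.Empty using (⊥)
open import Data.Unit using () renaming (⊤ to Unit)
open import Relation.Nullary using (¬_)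
open import Relation.Binary.PropositionalEquality using (_≡_; _≢_)
open import Function.Bundles using (_⇔_; _↔_; Inverse)

-- Digraphs on the vertex set Fin n: an arc relation  arc u v  means u → v.

Digraph : ℕ → Set₁
Digraph n = Fin n → Fin n → Set

InB : ∀ {n} → Digraph n → Fin n → Fin n → Set
InB D u w = (w ≡ u) ⊎ D w u

Separates : ∀ {n} → Digraph n → Subset n → Fin n → Fin n → Set
Separates D C u v = ¬ (∀ w → (w ∈ C × InB D u w) ⇔ (w ∈ C × InB D v w))

IsSeparatingCode : ∀ {n} → Digraph n → Subset n → Set
IsSeparatingCode D C = ∀ u v → u ≢ v → Separates D C u v

IsDominating : ∀ {n} → Digraph n → Subset n → Set
IsDominating D C = ∀ u → ∃[ w ] (w ∈ C × InB D u w)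

IsIdentifyingCode : ∀ {n} → Digraph n → Subset n → Set
IsIdentifyingCode D C = IsDominating D C × IsSeparatingCode D C

IdCodeNumber : ∀ {n} → Digraph n → ℕ → Set
IdCodeNumber D k =
  (∃[ C ] (IsIdentifyingCode D C × ∣ C ∣ ≡ k)) ×
  (∀ C → IsIdentifyingCode D C → k ≤ ∣ C ∣)

V─ : ∀ {n} → Fin n → Subset n
V─ x = ⊤ ─ ⁅ x ⁆

IsSource : ∀ {n} → Digraph n → Fin n → Set
IsSource D x = ∀ w → ¬ D w x

data FTerm : Set where
  K₁  : FTerm
  _⊕_ : FTerm → FTerm → FTerm
  ◁_  : FTerm → FTerm

size : FTerm → ℕ
size K₁      = 1
size (s ⊕ t) = size s + size t
size (◁ t)   = suc (size t)

⊕-arc : ∀ {n m} → Digraph n → Digraph m → Digraph (n + m)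
⊕-arc {n} A B u v with splitAt n u | splitAt n v
... | inj₁ a | inj₁ b = A a b
... | inj₂ a | inj₂ b = B a b
... | inj₁ _ | inj₂ _ = ⊥
... | inj₂ _ | inj₁ _ = ⊥

◁-arc : ∀ {n} → Digraph n → Digraph (suc n)
◁-arc A zero    zero    = ⊥
◁-arc A zero    (suc v) = Unit
◁-arc A (suc u) zero    = ⊥
◁-arc A (suc u) (suc v) = A u v

⟦_⟧ : (t : FTerm) → Digraph (size t)
⟦ K₁ ⟧    = λ _ _ → ⊥
⟦ s ⊕ t ⟧ = ⊕-arc ⟦ s ⟧ ⟦ t ⟧
⟦ ◁ t ⟧   = ◁-arc ⟦ t ⟧

_≅_ : ∀ {n m} → Digraph n → Digraph m → Set
_≅_ {n} {m} D E =
  Σ (Fin n ↔ Fin m) λ f →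
    ∀ u v → D u v ⇔ E (Inverse.to f u) (Inverse.to f v)

InF : ∀ {n} → Digraph n → Set
InF D = ∃[ t ] (D ≅ ⟦ t ⟧)

data Path {n} (T : Digraph n) : Fin n → Fin n → Set where
  [_] : ∀ {x y} → T x y → Path T x y
  _∷_ : ∀ {x y z} → T x y → Path T y z → Path T x z

IsTransitiveClosureOf : ∀ {n} → Digraph n → Digraph n → Set
IsTransitiveClosureOf D T = ∀ u v → D u v ⇔ Path T u v

IsRootedOrientedForest : ∀ {n} → Digraph n → Set
IsRootedOrientedForest T =
  (∀ u v w → T u w → T v w → u ≡ v) × (∀ u → ¬ Path T u u)

-- Every digraph of F is a strict order (asymmetric and transitive) in which
-- each vertex x with a predecessor has a father p, a predecessor with
-- B₁⁺(p) ⊇ B₁⁺(x) − x; these properties survive ⊕ and ◁.  Transitivity then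
-- gives B₁⁺(p) = B₁⁺(x) − x, so a code missing x cannot separate x from p, and
-- a source outside the code is not dominated: identifying codes are all of
-- V(D).  Against V(D) − x, asymmetry separates any two distinct vertices of the
-- code, while x is separated from every vertex except its father.
module Submission where

open import Defs
open import Level using (Level; _⊔_)
open import Data.Nat using (ℕ; _≤_)
open import Data.Fin using (Fin; zero; suc; splitAt; _≟_)
open import Data.Fin.Properties using (any?; +↔⊎)
open import Data.Fin.Subset using (Subset; _∈_; _∉_; ∣_∣; ⊤)
open import Data.Fin.Subset.Properties using (_∈?_; ∈⊤; ∣⊤∣≡n; p⊆q⇒∣p∣≤∣q∣; x∈p∧x≢y⇒x∈p-y)
open import Data.Vec.Base using (there)
open import Data.Product using (_×_; ∃-syntax; _,_; proj₁)
open import Data.Sum as Sum using (_⊎_; inj₁; inj₂)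
open import Data.Sum.Relation.Binary.Pointwise using (Pointwise; inj₁; inj₂; ⊎-asymmetric; ⊎-transitive; ⊎-decidable)
open import Data.Empty using (⊥-elim)
open import Data.Unit using (tt)
open import Function using (_∘_; id)
open import Function.Bundles using (_⇔_; _↔_; mk⇔; Equivalence; Inverse)
open import Relation.Binary.Core using (Rel)
open import Relation.Binary.Definitions using (Asymmetric; Transitive; Decidable)
open import Relation.Binary.PropositionalEquality using (_≡_; _≢_; refl; sym; trans; cong; subst)
open import Relation.Nullary using (¬_; yes; no)
import Relation.Nullary.Decidable as Dec
open import Relation.Nullary.Decidable using (decidable-stable)
open import Relation.Nullary.Negation using (¬¬-map)

open Equivalence using (to; from)

private
  variable
    a b ℓ : Level
    A : Set a
    B : Set b
    n : ℕ

IsImmediatePredecessor : {A : Set a} → Rel A ℓ → A → A → Set (a ⊔ ℓ)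
IsImmediatePredecessor _<_ p x = p < x × (∀ {w} → w < x → w ≡ p ⊎ w < p)

record IsForestOrder {A : Set a} (_<_ : Rel A ℓ) : Set (a ⊔ ℓ) where
  field
    asymmetric           : Asymmetric _<_
    transitive           : Transitive _<_
    decidable            : Decidable _<_
    immediatePredecessor : ∀ {w x} → w < x → ∃[ p ] IsImmediatePredecessor _<_ p x

open IsForestOrder

isForestOrder-pullback : {R : Rel A ℓ} {S : Rel B ℓ} (f : A ↔ B) →
  (∀ u v → R u v ⇔ S (Inverse.to f u) (Inverse.to f v)) →
  IsForestOrder S → IsForestOrder R
isForestOrder-pullback {R = R} {S} f R⇔S F = record
  { asymmetric           = λ u<v v<u → asymmetric F (⇒ u<v) (⇒ v<u)
  ; transitive           = λ u<v v<w → ⇐ (transitive F (⇒ u<v) (⇒ v<w))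
  ; decidable            = λ u v → Dec.map′ ⇐ ⇒ (decidable F _ _)
  ; immediatePredecessor = predecessor
  }
  where
  open Inverse f using () renaming (to to φ; from to ψ)
  φψ : ∀ y → φ (ψ y) ≡ y
  φψ = Inverse.strictlyInverseˡ f
  ψφ : ∀ x → ψ (φ x) ≡ x
  ψφ = Inverse.strictlyInverseʳ f
  ⇒ : ∀ {u v} → R u v → S (φ u) (φ v)
  ⇒ = to (R⇔S _ _)
  ⇐ : ∀ {u v} → S (φ u) (φ v) → R u v
  ⇐ = from (R⇔S _ _)
  ⇐ψ : ∀ {u p} → S (φ u) p → R u (ψ p)
  ⇐ψ {u} {p} = ⇐ ∘ subst (S (φ u)) (sym (φψ p))
  predecessor : ∀ {w x} → R w x → ∃[ p ] IsImmediatePredecessor R p x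
  predecessor {x = x} w<x with immediatePredecessor F (⇒ w<x)
  ... | p , p<x , below = ψ p , ⇐ (subst (λ z → S z (φ x)) (sym (φψ p)) p<x) , pulled
    where
    pulled : ∀ {w} → R w x → w ≡ ψ p ⊎ R w (ψ p)
    pulled {w} w<x = Sum.map (λ e → trans (sym (ψφ w)) (cong ψ e)) ⇐ψ (below (⇒ w<x))

⊎-isForestOrder : {R : Rel A ℓ} {S : Rel B ℓ} →
  IsForestOrder R → IsForestOrder S → IsForestOrder (Pointwise R S)
⊎-isForestOrder F G = record
  { asymmetric           = ⊎-asymmetric (asymmetric F) (asymmetric G)
  ; transitive           = ⊎-transitive (transitive F) (transitive G)
  ; decidable            = ⊎-decidable (decidable F) (decidable G)
  ; immediatePredecessor = predecessor
  }
  where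
  predecessor : ∀ {w x} → Pointwise _ _ w x → ∃[ p ] IsImmediatePredecessor (Pointwise _ _) p x
  predecessor (inj₁ w<x) with immediatePredecessor F w<x
  ... | p , p<x , below = inj₁ p , inj₁ p<x , λ { (inj₁ v<x) → Sum.map (cong inj₁) inj₁ (below v<x) }
  predecessor (inj₂ w<x) with immediatePredecessor G w<x
  ... | p , p<x , below = inj₂ p , inj₂ p<x , λ { (inj₂ v<x) → Sum.map (cong inj₂) inj₂ (below v<x) }

source-or-predecessor : {D : Digraph n} → Decidable D → ∀ x → IsSource D x ⊎ ∃[ w ] D w x
source-or-predecessor dec x with any? (λ w → dec w x)
... | yes predecessor = inj₂ predecessor
... | no ¬predecessor = inj₁ (λ w w→x → ¬predecessor (w , w→x))

◁-isForestOrder : {D : Digraph n} → IsForestOrder D → IsForestOrder (◁-arc D)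
◁-isForestOrder {D = D} F = record
  { asymmetric           = λ {u v} → asym {u} {v}
  ; transitive           = λ {u v w} → tra {u} {v} {w}
  ; decidable            = dec
  ; immediatePredecessor = λ {w x} → predecessor {w} {x}
  }
  where
  E = ◁-arc D
  asym : Asymmetric E
  asym {zero}  {suc _} _ ()
  asym {suc _} {suc _} = asymmetric F
  tra : Transitive E
  tra {zero}  {suc _} {suc _} _ _ = tt
  tra {suc _} {suc _} {suc _}     = transitive F
  dec : Decidable E
  dec zero    zero    = no λ ()
  dec zero    (suc v) = yes tt
  dec (suc u) zero    = no λ ()
  dec (suc u) (suc v) = decidable F u v
  predecessor : ∀ {w x} → E w x → ∃[ p ] IsImmediatePredecessor E p x
  predecessor {zero}  {zero} ()
  predecessor {suc _} {zero} ()
  -- The new vertex is the father of exactly the old sources.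
  predecessor {x = suc x} _ with source-or-predecessor (decidable F) x
  ... | inj₁ source = zero , tt , λ { {zero} _ → inj₁ refl ; {suc w} w→x → ⊥-elim (source w w→x) }
  ... | inj₂ (_ , w→x) with immediatePredecessor F w→x
  ...   | p , p→x , below =
          suc p , p→x , λ { {zero} _ → inj₂ tt ; {suc w} w→x → Sum.map (cong suc) id (below w→x) }

⊕-arc⇔Pointwise : ∀ {n m} (A : Digraph n) (B : Digraph m) u v →
  ⊕-arc A B u v ⇔ Pointwise A B (splitAt n u) (splitAt n v)
⊕-arc⇔Pointwise {n} A B u v with splitAt n u | splitAt n v
... | inj₁ _ | inj₁ _ = mk⇔ inj₁ λ { (inj₁ d) → d }
... | inj₂ _ | inj₂ _ = mk⇔ inj₂ λ { (inj₂ d) → d }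
... | inj₁ _ | inj₂ _ = mk⇔ (λ ()) (λ ())
... | inj₂ _ | inj₁ _ = mk⇔ (λ ()) (λ ())

⟦⟧-isForestOrder : ∀ t → IsForestOrder ⟦ t ⟧
⟦⟧-isForestOrder K₁ = record
  { asymmetric = λ () ; transitive = λ () ; decidable = λ _ _ → no λ () ; immediatePredecessor = λ () }
⟦⟧-isForestOrder (s ⊕ t) =
  isForestOrder-pullback +↔⊎ (⊕-arc⇔Pointwise ⟦ s ⟧ ⟦ t ⟧)
    (⊎-isForestOrder (⟦⟧-isForestOrder s) (⟦⟧-isForestOrder t))
⟦⟧-isForestOrder (◁ t) = ◁-isForestOrder (⟦⟧-isForestOrder t)

InF⇒isForestOrder : {D : Digraph n} → InF D → IsForestOrder D
InF⇒isForestOrder (t , f , D⇔⟦t⟧) = isForestOrder-pullback f D⇔⟦t⟧ (⟦⟧-isForestOrder t)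

module _ {D : Digraph n} where

  arc⇒≢ : Asymmetric D → ∀ {u v} → D u v → u ≢ v
  arc⇒≢ asym u→u refl = asym u→u u→u

  -- Separates D C is definitionally ¬ SameTrace C.
  SameTrace : Subset n → Fin n → Fin n → Set
  SameTrace C u v = ∀ w → (w ∈ C × InB D u w) ⇔ (w ∈ C × InB D v w)

  SameTrace-sym : ∀ {C u v} → SameTrace C u v → SameTrace C v u
  SameTrace-sym same w = mk⇔ (from (same w)) (to (same w))

  Separates-sym : ∀ {C u v} → Separates D C u v → Separates D C v u
  Separates-sym sep = sep ∘ SameTrace-sym

  SameTrace⇒InB : ∀ {C u v w} → SameTrace C u v → w ∈ C → InB D u w → InB D v w
  SameTrace⇒InB same w∈C w∈Bu with to (same _) (w∈C , w∈Bu)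
  ... | _ , w∈Bv = w∈Bv

  separates-members : Asymmetric D → ∀ {C u v} → u ∈ C → v ∈ C → u ≢ v → Separates D C u v
  separates-members asym u∈C v∈C u≢v same
    with SameTrace⇒InB same u∈C (inj₁ refl) | SameTrace⇒InB (SameTrace-sym same) v∈C (inj₁ refl)
  ... | inj₁ u≡v | _        = u≢v u≡v
  ... | _        | inj₁ v≡u = u≢v (sym v≡u)
  ... | inj₂ u→v | inj₂ v→u = asym u→v v→u

  separates-source : ∀ {C x v} → IsSource D x → v ∈ C → v ≢ x → Separates D C x v
  separates-source source v∈C v≢x same with SameTrace⇒InB (SameTrace-sym same) v∈C (inj₁ refl)
  ... | inj₁ v≡x = v≢x v≡x
  ... | inj₂ v→x = source _ v→x

  immediatePredecessor-sameTrace : Transitive D → ∀ {C x p} → x ∉ C →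
    IsImmediatePredecessor D p x → SameTrace C x p
  immediatePredecessor-sameTrace transitive-D {C} {x} {p} x∉C (p→x , below) w = mk⇔ ⇒ ⇐
    where
    ⇒ : w ∈ C × InB D x w → w ∈ C × InB D p w
    ⇒ (w∈C , inj₁ refl) = ⊥-elim (x∉C w∈C)
    ⇒ (w∈C , inj₂ w→x)  = w∈C , below w→x
    ⇐ : w ∈ C × InB D p w → w ∈ C × InB D x w
    ⇐ (w∈C , inj₁ refl) = w∈C , inj₂ p→x
    ⇐ (w∈C , inj₂ w→p)  = w∈C , inj₂ (transitive-D w→p p→x)

  sameTrace⇒≡immediatePredecessor : Asymmetric D → ∀ {C x p v} → x ∉ C →
    IsImmediatePredecessor D p x → p ∈ C → v ∈ C → SameTrace C x v → v ≡ p
  sameTrace⇒≡immediatePredecessor asym x∉C (p→x , below) p∈C v∈C same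
    with SameTrace⇒InB same p∈C (inj₂ p→x) | SameTrace⇒InB (SameTrace-sym same) v∈C (inj₁ refl)
  ... | inj₁ p≡v | _        = sym p≡v
  ... | _        | inj₁ refl = ⊥-elim (x∉C v∈C)
  ... | inj₂ p→v | inj₂ v→x with below v→x
  ...   | inj₁ v≡p = v≡p
  ...   | inj₂ v→p = ⊥-elim (asym p→v v→p)

  identifyingCode-contains : IsForestOrder D → ∀ {C} → IsIdentifyingCode D C → ∀ x → x ∈ C
  identifyingCode-contains F {C} (dominating , separating) x =
    decidable-stable (x ∈? C) outside-impossible
    where
    outside-impossible : ¬ x ∉ C
    outside-impossible x∉C with source-or-predecessor (decidable F) x
    ... | inj₁ source with dominating x
    ...   | _ , w∈C , inj₁ refl = x∉C w∈C
    ...   | w , _   , inj₂ w→x  = source w w→x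
    outside-impossible x∉C | inj₂ (_ , w→x) with immediatePredecessor F w→x
    ... | p , father@(p→x , _) =
          separating x p (arc⇒≢ (asymmetric F) p→x ∘ sym)
            (immediatePredecessor-sameTrace (transitive F) x∉C father)

  idCodeNumber : IsForestOrder D → IdCodeNumber D n
  idCodeNumber F = (⊤ , ⊤-identifying , ∣⊤∣≡n n) , λ C identifying →
    subst (_≤ ∣ C ∣) (∣⊤∣≡n n)
      (p⊆q⇒∣p∣≤∣q∣ {p = ⊤} λ {x} _ → identifyingCode-contains F identifying x)
    where
    ⊤-identifying : IsIdentifyingCode D ⊤
    ⊤-identifying = (λ u → u , ∈⊤ , inj₁ refl) , λ _ _ → separates-members (asymmetric F) ∈⊤ ∈⊤

x∉V─x : (x : Fin n) → x ∉ V─ x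
x∉V─x zero    ()
x∉V─x (suc x) (there x∈V─x) = x∉V─x x x∈V─x

∈V─ : ∀ {x w : Fin n} → w ≢ x → w ∈ V─ x
∈V─ = x∈p∧x≢y⇒x∈p-y ∈⊤

V─source-isSeparatingCode : {D : Digraph n} → Asymmetric D → ∀ {x} → IsSource D x →
  IsSeparatingCode D (V─ x)
V─source-isSeparatingCode asym {x} source u v u≢v with u ≟ x | v ≟ x
... | yes refl | yes refl = ⊥-elim (u≢v refl)
... | yes refl | no v≢x   = separates-source source (∈V─ v≢x) v≢x
... | no u≢x   | yes refl = Separates-sym (separates-source source (∈V─ u≢x) u≢x)
... | no u≢x   | no v≢x   = separates-members asym (∈V─ u≢x) (∈V─ v≢x) u≢v

unsnoc : ∀ {T : Digraph n} {u v} → Path T u v → T u v ⊎ ∃[ z ] (Path T u z × T z v)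
unsnoc [ u⇒v ] = inj₁ u⇒v
unsnoc (u⇒w ∷ w⇒⁺v) with unsnoc w⇒⁺v
... | inj₁ w⇒v            = inj₂ (_ , [ u⇒w ] , w⇒v)
... | inj₂ (z , w⇒⁺z , z⇒v) = inj₂ (z , u⇒w ∷ w⇒⁺z , z⇒v)

father-exists : {D T : Digraph n} → IsTransitiveClosureOf D T → Decidable D →
  ∀ {x} → ¬ IsSource D x → ∃[ y ] T y x
father-exists closure dec {x} ¬source with source-or-predecessor dec x
... | inj₁ source = ⊥-elim (¬source source)
... | inj₂ (w , w→x) with unsnoc (to (closure w x) w→x)
...   | inj₁ w⇒x           = w , w⇒x
...   | inj₂ (z , _ , z⇒x) = z , z⇒x

module _ {D T : Digraph n} (forest : IsRootedOrientedForest T) (closure : IsTransitiveClosureOf D T) where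

  father-isImmediatePredecessor : ∀ {y x} → T y x → IsImmediatePredecessor D y x
  father-isImmediatePredecessor {y} {x} y⇒x = from (closure y x) [ y⇒x ] , below
    where
    unique-father : ∀ {z} → T z x → z ≡ y
    unique-father z⇒x = proj₁ forest _ _ x z⇒x y⇒x
    below : ∀ {w} → D w x → w ≡ y ⊎ D w y
    below {w} w→x with unsnoc (to (closure w x) w→x)
    ... | inj₁ w⇒x              = inj₁ (unique-father w⇒x)
    ... | inj₂ (_ , w⇒⁺z , z⇒x) = inj₂ (from (closure w y) (subst (Path T w) (unique-father z⇒x) w⇒⁺z))

  module _ (F : IsForestOrder D) {x} (¬source : ¬ IsSource D x) where

    unseparated⇒father : ∀ {v} → v ≢ x → ¬ Separates D (V─ x) x v → T v x
    unseparated⇒father {v} v≢x unseparated with father-exists closure (decidable F) ¬source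
    ... | y , y⇒x = subst (λ z → T z x) (sym v≡y) y⇒x
      where
      father = father-isImmediatePredecessor y⇒x
      y≢x = arc⇒≢ (asymmetric F) (proj₁ father)
      v≡y : v ≡ y
      v≡y = decidable-stable (v ≟ y)
        (¬¬-map (sameTrace⇒≡immediatePredecessor (asymmetric F) (x∉V─x x) father (∈V─ y≢x) (∈V─ v≢x))
          unseparated)

    unseparated-pairs : ∀ u v → u ≢ v →
      (¬ Separates D (V─ x) u v) ⇔ ((u ≡ x × T v x) ⊎ (v ≡ x × T u x))
    unseparated-pairs u v u≢v = mk⇔ classify exhibit
      where
      classify : ¬ Separates D (V─ x) u v → (u ≡ x × T v x) ⊎ (v ≡ x × T u x)
      classify unseparated with u ≟ x | v ≟ x
      ... | yes refl | yes refl = ⊥-elim (u≢v refl)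
      ... | yes refl | no v≢x   = inj₁ (refl , unseparated⇒father v≢x unseparated)
      ... | no u≢x   | yes refl = inj₂ (refl , unseparated⇒father u≢x (unseparated ∘ Separates-sym))
      ... | no u≢x   | no v≢x   =
            ⊥-elim (unseparated (separates-members (asymmetric F) (∈V─ u≢x) (∈V─ v≢x) u≢v))
      father-sameTrace : ∀ {y} → T y x → SameTrace (V─ x) x y
      father-sameTrace y⇒x =
        immediatePredecessor-sameTrace (transitive F) (x∉V─x x) (father-isImmediatePredecessor y⇒x)
      exhibit : (u ≡ x × T v x) ⊎ (v ≡ x × T u x) → ¬ Separates D (V─ x) u v
      exhibit (inj₁ (refl , v⇒x)) separated = separated (father-sameTrace v⇒x)
      exhibit (inj₂ (refl , u⇒x)) separated = Separates-sym separated (father-sameTrace u⇒x)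

proposition1 : ∀ {n} (D : Digraph n) → InF D →
    IdCodeNumber D n ×
    (∀ x →
      (IsSource D x → IsSeparatingCode D (V─ x)) ×
      (¬ IsSource D x →
        ∀ (T : Digraph n) → IsRootedOrientedForest T → IsTransitiveClosureOf D T →
          (∃[ y ] T y x) ×
          (∀ u v → u ≢ v →
            ((¬ Separates D (V─ x) u v) ⇔ ((u ≡ x × T v x) ⊎ (v ≡ x × T u x))))))
proposition1 D inF =
  idCodeNumber F ,
  λ x → V─source-isSeparatingCode (asymmetric F) ,
        λ ¬source T forest closure →
          father-exists closure (decidable F) ¬source ,
          unseparated-pairs forest closure F ¬source
  where
  F = InF⇒isForestOrder inF
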